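{- Let $n\geq 2$ and $G=C_n\oplus C_n$. Let $(e_1,e_2)$ be a basis of $G$, let $x_1,x_2\in[0,n-1]$, and let $S=e_1^{[n-1]}\boldsymbol{\cdot}e_2^{[n-1]}\boldsymbol{\cdot}(x_1e_1+x_2e_2)^{[n-1]}$. Then $0\notin\Sigma_{\leq n}(S)$ if and only if $(-x_1k)_n+(-x_2k)_n+(k)_n>n$ for every $k\in[1,n-1]$.
   Context: $C_n$ denotes a cyclic group of order $n$; $[x,y]=\{z\in\mathbb Z:x\le z\le y\}$. For an integer $x$, $(x)_n\in[0,n-1]$ is the least non-negative residue of $x$ modulo $n$. A basis $(e_1,e_2)$ of $G$ means $G=\langle e_1\rangle\oplus\langle e_2\rangle$ with $\mathrm{ord}(e_1)=\mathrm{ord}(e_2)=n$. A sequence is a finite multiset of elements of $G$; $g^{[t]}$ is $g$ repeated $t$ times and $\boldsymbol{\cdot}$ is concatenation. $\Sigma_{\leq n}(S)$ is the set of sums of the terms of subsequences $T$ of $S$ with $1\le|T|\le n$. -}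

module Defs where

open import Data.Nat using (ℕ; _+_; _≤_; _∸_)
open import Data.Nat.Divisibility using (_∣_)
open import Data.Product using (_×_; _,_; proj₁; proj₂; ∃-syntax)
open import Data.List using (List; []; _∷_; _++_; replicate; length)
open import Data.List.Relation.Binary.Sublist.Propositional using (_⊆_)

-- An element of G = C_n ⊕ C_n, written in coordinates (a , b) with respect to
-- the basis (e₁ , e₂), i.e. the element a·e₁ + b·e₂.
Elt : Set
Elt = ℕ × ℕ

σ : List Elt → Elt
σ []             = 0 , 0
σ ((a , b) ∷ T) = (a + proj₁ (σ T)) , (b + proj₂ (σ T))

IsZero : ℕ → Elt → Set
IsZero n g = (n ∣ proj₁ g) × (n ∣ proj₂ g)

ZeroInΣ≤ : ℕ → List Elt → Set
ZeroInΣ≤ n S = ∃[ T ] ((T ⊆ S) × (1 ≤ length T) × (length T ≤ n) × IsZero n (σ T))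

seqS : ℕ → ℕ → ℕ → List Elt
seqS n x₁ x₂ = replicate (n ∸ 1) (1 , 0) ++ replicate (n ∸ 1) (0 , 1) ++ replicate (n ∸ 1) (x₁ , x₂)

-- A subsequence of S is e₁^[a] · e₂^[b] · g^[c] with a, b, c ≤ n - 1, where g = x₁e₁ + x₂e₂;
-- its sum is a + c x₁, b + c x₂ in coordinates. Since a, b < n, it vanishes exactly when
-- a = (-x₁c)ₙ and b = (-x₂c)ₙ, and c = 0 then forces the empty sequence. So a zero sum of
-- length at most n exists iff (-x₁k)ₙ + (-x₂k)ₙ + k ≤ n for some k ∈ [1, n - 1].
module Submission where

open import Defs
open import Data.Nat using (ℕ; NonZero; _+_; _≤_; _<_; _>_; _∸_; _%_)
open import Data.Integer using (+_; -_; _*_)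
open import Data.Integer.DivMod using (_%ℕ_)
open import Relation.Nullary using (¬_)
open import Function.Bundles using (_⇔_)

open import Data.Nat as ℕ using (zero; suc; z≤n; s≤s)
open import Data.Nat.Properties
open import Data.Nat.Divisibility using (_∣_; divides; _∣0; ∣m+n∣m⇒∣n; >⇒∤)
open import Data.Nat.DivMod using (m<n⇒m%n≡m)
open import Data.Integer as ℤ using (∣_∣)
open import Data.Integer.Properties using (pos-+; pos-*; neg-involutive; ∣-i∣≡∣i∣; abs-*)
open import Data.Integer.DivMod using (_/ℕ_; a≡a%ℕn+[a/ℕn]*n; n%ℕd<d)
open import Data.Integer.Tactic.RingSolver using (solve-∀)
open import Data.Product using (_×_; _,_; proj₁; proj₂; ∃-syntax)
open import Data.Sum using (inj₁; inj₂)
open import Data.List using (List; []; _∷_; _++_; replicate; length)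
open import Data.List.Properties using (length-++; length-replicate)
open import Data.List.Relation.Binary.Sublist.Propositional using (_⊆_; []; _∷ʳ_; _∷_)
open import Data.List.Relation.Binary.Sublist.Propositional.Properties using (++⁺)
open import Relation.Binary.PropositionalEquality
open import Relation.Nullary using (contradiction)
open import Function.Bundles using (mk⇔)
open import Function.Base using (_∘_)

module Residues (n : ℕ) .{{_ : NonZero n}} where

  ∣[-m]%n+m : ∀ m → n ∣ (- + m) %ℕ n + m
  ∣[-m]%n+m m = divides ∣ q ∣ (begin
    r + m                ≡⟨ cong ∣_∣ (pos-+ r m) ⟩
    ∣ + r ℤ.+ + m ∣      ≡⟨ cong ∣_∣ residue+m ⟩
    ∣ - (q * + n) ∣      ≡⟨ ∣-i∣≡∣i∣ (q * + n) ⟩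
    ∣ q * + n ∣          ≡⟨ abs-* q (+ n) ⟩
    ∣ q ∣ ℕ.* n          ∎)
    where
    open ≡-Reasoning
    r = (- + m) %ℕ n
    q = (- + m) /ℕ n
    residue+m : + r ℤ.+ + m ≡ - (q * + n)
    residue+m = begin
      + r ℤ.+ + m               ≡⟨ cong (λ i → + r ℤ.+ i) (neg-involutive (+ m)) ⟨
      + r ℤ.+ - (- + m)         ≡⟨ cong (λ i → + r ℤ.+ - i) (a≡a%ℕn+[a/ℕn]*n (- + m) n) ⟩
      + r ℤ.+ - (+ r ℤ.+ q * + n) ≡⟨ i+-[i+j]≡-j (+ r) (q * + n) ⟩
      - (q * + n)               ∎
      where
      i+-[i+j]≡-j : ∀ i j → i ℤ.+ - (i ℤ.+ j) ≡ - j
      i+-[i+j]≡-j = solve-∀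

  residue-unique-≤ : ∀ {a b m} → a ≤ b → b < n → n ∣ a + m → n ∣ b + m → a ≡ b
  residue-unique-≤ {a} {b} {m} a≤b b<n n∣a+m n∣b+m =
    ≤-antisym a≤b (m∸n≡0⇒m≤n (multiple-below-n≡0 (∣m+n∣m⇒∣n n∣sum n∣a+m) (≤-<-trans (m∸n≤m b a) b<n)))
    where
    n∣sum : n ∣ (a + m) + (b ∸ a)
    n∣sum = subst (n ∣_) (sym (begin
      a + m + (b ∸ a)   ≡⟨ +-assoc a m (b ∸ a) ⟩
      a + (m + (b ∸ a)) ≡⟨ cong (λ t → a + t) (+-comm m (b ∸ a)) ⟩
      a + (b ∸ a + m)   ≡⟨ +-assoc a (b ∸ a) m ⟨
      a + (b ∸ a) + m   ≡⟨ cong (_+ m) (m+[n∸m]≡n a≤b) ⟩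
      b + m             ∎)) n∣b+m
      where open ≡-Reasoning
    multiple-below-n≡0 : ∀ {d} → n ∣ d → d < n → d ≡ 0
    multiple-below-n≡0 {zero}  _   _   = refl
    multiple-below-n≡0 {suc d} n∣d d<n = contradiction n∣d (>⇒∤ d<n)

  residue-unique : ∀ {a b m} → a < n → b < n → n ∣ a + m → n ∣ b + m → a ≡ b
  residue-unique {a} {b} a<n b<n n∣a+m n∣b+m with ≤-total a b
  ... | inj₁ a≤b = residue-unique-≤ a≤b b<n n∣a+m n∣b+m
  ... | inj₂ b≤a = sym (residue-unique-≤ b≤a a<n n∣b+m n∣a+m)

  negMod : ℕ → ℕ → ℕ
  negMod x k = (- (+ x * + k)) %ℕ n

  negMod<n : ∀ x k → negMod x k < n
  negMod<n x k = n%ℕd<d (- (+ x * + k)) n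

  ∣negMod+k*x : ∀ x k → n ∣ negMod x k + k ℕ.* x
  ∣negMod+k*x x k = subst₂ (λ i m → n ∣ (- i) %ℕ n + m) (pos-* x k) (*-comm x k) (∣[-m]%n+m (x ℕ.* k))

  negMod-zero : ∀ x → negMod x 0 ≡ 0
  negMod-zero x = residue-unique (negMod<n x 0) (ℕ.>-nonZero⁻¹ n) (∣negMod+k*x x 0) (n ∣0)

module _ {A : Set} where

  ⊆-++⁻ : ∀ (xs ys : List A) {T} → T ⊆ xs ++ ys →
          ∃[ T₁ ] ∃[ T₂ ] (T ≡ T₁ ++ T₂ × T₁ ⊆ xs × T₂ ⊆ ys)
  ⊆-++⁻ []       ys T⊆ys      = [] , _ , refl , [] , T⊆ys
  ⊆-++⁻ (x ∷ xs) ys (.x ∷ʳ T⊆) with ⊆-++⁻ xs ys T⊆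
  ... | T₁ , T₂ , refl , T₁⊆xs , T₂⊆ys = T₁ , T₂ , refl , x ∷ʳ T₁⊆xs , T₂⊆ys
  ⊆-++⁻ (x ∷ xs) ys (refl ∷ T⊆) with ⊆-++⁻ xs ys T⊆
  ... | T₁ , T₂ , refl , T₁⊆xs , T₂⊆ys = x ∷ T₁ , T₂ , refl , refl ∷ T₁⊆xs , T₂⊆ys

  ⊆-replicate⁻ : ∀ m (x : A) {T} → T ⊆ replicate m x → T ≡ replicate (length T) x × length T ≤ m
  ⊆-replicate⁻ zero    x []         = refl , z≤n
  ⊆-replicate⁻ (suc m) x (.x ∷ʳ T⊆) with ⊆-replicate⁻ m x T⊆
  ... | T≡ , len≤ = T≡ , m≤n⇒m≤1+n len≤
  ⊆-replicate⁻ (suc m) x (refl ∷ T⊆) with ⊆-replicate⁻ m x T⊆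
  ... | T≡ , len≤ = cong (x ∷_) T≡ , s≤s len≤

  replicate-⊆ : ∀ {a m} (x : A) → a ≤ m → replicate a x ⊆ replicate m x
  replicate-⊆ {zero}  {zero}  x z≤n     = []
  replicate-⊆ {zero}  {suc m} x z≤n     = x ∷ʳ replicate-⊆ x z≤n
  replicate-⊆ {suc a} {suc m} x (s≤s a≤m) = refl ∷ replicate-⊆ x a≤m

_⊕_ : Elt → Elt → Elt
g ⊕ h = proj₁ g + proj₁ h , proj₂ g + proj₂ h

⊕-assoc : ∀ f g h → (f ⊕ g) ⊕ h ≡ f ⊕ (g ⊕ h)
⊕-assoc f g h = cong₂ _,_ (+-assoc (proj₁ f) _ _) (+-assoc (proj₂ f) _ _)

σ-++ : ∀ xs ys → σ (xs ++ ys) ≡ σ xs ⊕ σ ys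
σ-++ []       ys = refl
σ-++ (x ∷ xs) ys = trans (cong (x ⊕_) (σ-++ xs ys)) (sym (⊕-assoc x (σ xs) (σ ys)))

σ-replicate : ∀ m a b → σ (replicate m (a , b)) ≡ (m ℕ.* a , m ℕ.* b)
σ-replicate zero    a b = refl
σ-replicate (suc m) a b = cong ((a , b) ⊕_) (σ-replicate m a b)

-- seqS n x₁ x₂ is definitionally blocks (x₁ , x₂) (n ∸ 1) (n ∸ 1) (n ∸ 1).
blocks : Elt → ℕ → ℕ → ℕ → List Elt
blocks g a b c = replicate a (1 , 0) ++ replicate b (0 , 1) ++ replicate c g

length-blocks : ∀ g a b c → length (blocks g a b c) ≡ a + (b + c)
length-blocks g a b c = begin
  length (blocks g a b c)
    ≡⟨ length-++ (replicate a (1 , 0)) ⟩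
  length (replicate a (1 , 0)) + length (replicate b (0 , 1) ++ replicate c g)
    ≡⟨ cong₂ _+_ (length-replicate a) (length-++ (replicate b (0 , 1))) ⟩
  a + (length (replicate b (0 , 1)) + length (replicate c g))
    ≡⟨ cong₂ (λ u v → a + (u + v)) (length-replicate b) (length-replicate c) ⟩
  a + (b + c)
    ∎
  where open ≡-Reasoning

σ-blocks : ∀ x₁ x₂ a b c → σ (blocks (x₁ , x₂) a b c) ≡ (a + c ℕ.* x₁ , b + c ℕ.* x₂)
σ-blocks x₁ x₂ a b c = begin
  σ (blocks (x₁ , x₂) a b c)
    ≡⟨ σ-++ (replicate a (1 , 0)) _ ⟩
  σ (replicate a (1 , 0)) ⊕ σ (replicate b (0 , 1) ++ replicate c (x₁ , x₂))
    ≡⟨ cong (σ (replicate a (1 , 0)) ⊕_) (σ-++ (replicate b (0 , 1)) _) ⟩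
  σ (replicate a (1 , 0)) ⊕ (σ (replicate b (0 , 1)) ⊕ σ (replicate c (x₁ , x₂)))
    ≡⟨ cong₂ _⊕_ (σ-replicate a 1 0) (cong₂ _⊕_ (σ-replicate b 0 1) (σ-replicate c x₁ x₂)) ⟩
  (a ℕ.* 1 + (b ℕ.* 0 + c ℕ.* x₁) , a ℕ.* 0 + (b ℕ.* 1 + c ℕ.* x₂))
    ≡⟨ cong₂ _,_ (cong₂ (λ u v → u + (v + c ℕ.* x₁)) (*-identityʳ a) (*-zeroʳ b))
                 (cong₂ (λ u v → u + (v + c ℕ.* x₂)) (*-zeroʳ a) (*-identityʳ b)) ⟩
  (a + c ℕ.* x₁ , b + c ℕ.* x₂)
    ∎
  where open ≡-Reasoning

blocks-⊆ : ∀ g {a b c p q r} → a ≤ p → b ≤ q → c ≤ r → blocks g a b c ⊆ blocks g p q r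
blocks-⊆ g a≤p b≤q c≤r =
  ++⁺ (replicate-⊆ (1 , 0) a≤p) (++⁺ (replicate-⊆ (0 , 1) b≤q) (replicate-⊆ g c≤r))

⊆-blocks⁻ : ∀ g p q r {T} → T ⊆ blocks g p q r →
            ∃[ a ] ∃[ b ] ∃[ c ] (T ≡ blocks g a b c × a ≤ p × b ≤ q × c ≤ r)
⊆-blocks⁻ g p q r T⊆
  with A , BC , refl , A⊆ , BC⊆ ← ⊆-++⁻ (replicate p (1 , 0)) _ T⊆
  with B , C , refl , B⊆ , C⊆ ← ⊆-++⁻ (replicate q (0 , 1)) _ BC⊆
  with A≡ , a≤p ← ⊆-replicate⁻ p (1 , 0) A⊆
  with B≡ , b≤q ← ⊆-replicate⁻ q (0 , 1) B⊆
  with C≡ , c≤r ← ⊆-replicate⁻ r g C⊆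
  = length A , length B , length C
  , cong₂ _++_ A≡ (cong₂ _++_ B≡ C≡) , a≤p , b≤q , c≤r

<⇒≤∸1 : ∀ {m n} → m < n → m ≤ n ∸ 1
<⇒≤∸1 (s≤s m≤n) = m≤n

≤∸1⇒< : ∀ {m n} .{{_ : NonZero n}} → m ≤ n ∸ 1 → m < n
≤∸1⇒< {n = suc _} = s≤s

module _ (n : ℕ) .{{_ : NonZero n}} (x₁ x₂ : ℕ) where

  open Residues n

  g : Elt
  g = x₁ , x₂

  residue-blocks-zero-sum : ∀ k → IsZero n (σ (blocks g (negMod x₁ k) (negMod x₂ k) k))
  residue-blocks-zero-sum k =
    subst (IsZero n) (sym (σ-blocks x₁ x₂ _ _ k)) (∣negMod+k*x x₁ k , ∣negMod+k*x x₂ k)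

  zero-sum-blocks⁻ : ∀ {a b c} → a < n → b < n → IsZero n (σ (blocks g a b c)) →
                     a ≡ negMod x₁ c × b ≡ negMod x₂ c
  zero-sum-blocks⁻ {a} {b} {c} a<n b<n zero-sum
    with n∣a+cx₁ , n∣b+cx₂ ← subst (IsZero n) (σ-blocks x₁ x₂ a b c) zero-sum
    = residue-unique a<n (negMod<n x₁ c) n∣a+cx₁ (∣negMod+k*x x₁ c)
    , residue-unique b<n (negMod<n x₂ c) n∣b+cx₂ (∣negMod+k*x x₂ c)

  Short : ℕ → Set
  Short k = negMod x₁ k + negMod x₂ k + k ≤ n

  short⇒zero-sum : ∀ {k} → 1 ≤ k → k ≤ n ∸ 1 → Short k → ZeroInΣ≤ n (seqS n x₁ x₂)
  short⇒zero-sum {k} 1≤k k≤n-1 short =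
    blocks g r₁ r₂ k
    , blocks-⊆ g (<⇒≤∸1 (negMod<n x₁ k)) (<⇒≤∸1 (negMod<n x₂ k)) k≤n-1
    , subst (1 ≤_) (sym (length-blocks g r₁ r₂ k)) (≤-trans 1≤k (≤-trans (m≤n+m k r₂) (m≤n+m _ r₁)))
    , subst (_≤ n) (trans (+-assoc r₁ r₂ k) (sym (length-blocks g r₁ r₂ k))) short
    , residue-blocks-zero-sum k
    where
    r₁ = negMod x₁ k
    r₂ = negMod x₂ k

  zero-sum⇒short : ZeroInΣ≤ n (seqS n x₁ x₂) → ∃[ k ] (1 ≤ k × k ≤ n ∸ 1 × Short k)
  zero-sum⇒short (T , T⊆ , 1≤|T| , |T|≤n , zero-sum)
    with a , b , c , refl , a≤ , b≤ , c≤ ← ⊆-blocks⁻ g _ _ _ T⊆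
    with refl , refl ← zero-sum-blocks⁻ (≤∸1⇒< a≤) (≤∸1⇒< b≤) zero-sum
    with c
  ... | zero = contradiction
        (subst₂ (λ u v → 1 ≤ length (blocks g u v 0)) (negMod-zero x₁) (negMod-zero x₂) 1≤|T|) λ ()
  ... | suc c' = suc c' , s≤s z≤n , c≤
        , subst (_≤ n) (trans (length-blocks g r₁ r₂ (suc c')) (sym (+-assoc r₁ r₂ (suc c')))) |T|≤n
    where
    r₁ = negMod x₁ (suc c')
    r₂ = negMod x₂ (suc c')

lemma2p1 : (n : ℕ) .{{_ : NonZero n}} → 2 ≤ n → (x₁ x₂ : ℕ) → x₁ < n → x₂ < n →
    ((¬ ZeroInΣ≤ n (seqS n x₁ x₂)) ⇔
      ((k : ℕ) → 1 ≤ k → k ≤ n ∸ 1 →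
        ((- (+ x₁ * + k)) %ℕ n) + ((- (+ x₂ * + k)) %ℕ n) + (k % n) > n))
lemma2p1 n _ x₁ x₂ _ _ = mk⇔
  (λ no-zero-sum k 1≤k k≤n-1 → ¬short⇒long k≤n-1 (no-zero-sum ∘ short⇒zero-sum n x₁ x₂ 1≤k k≤n-1))
  all-long⇒no-zero-sum
  where
  Long : ℕ → Set
  Long k = ((- (+ x₁ * + k)) %ℕ n) + ((- (+ x₂ * + k)) %ℕ n) + (k % n) > n

  ¬short⇒long : ∀ {k} → k ≤ n ∸ 1 → ¬ Short n x₁ x₂ k → Long k
  ¬short⇒long k≤n-1 ¬short rewrite m<n⇒m%n≡m (≤∸1⇒< k≤n-1) = ≰⇒> ¬short

  long⇒¬short : ∀ {k} → k ≤ n ∸ 1 → Long k → ¬ Short n x₁ x₂ k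
  long⇒¬short k≤n-1 long rewrite m<n⇒m%n≡m (≤∸1⇒< k≤n-1) = <⇒≱ long

  all-long⇒no-zero-sum : (∀ k → 1 ≤ k → k ≤ n ∸ 1 → Long k) → ¬ ZeroInΣ≤ n (seqS n x₁ x₂)
  all-long⇒no-zero-sum all-long zero-sum
    with k , 1≤k , k≤n-1 , short ← zero-sum⇒short n x₁ x₂ zero-sum
    = long⇒¬short k≤n-1 (all-long k 1≤k k≤n-1) short
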